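{- Let $G$ be a connected graph (multiple edges allowed) on vertex set $\{v_1,\dots,v_n\}$ with $n\ge 3$ and adjacency matrix $A=(a_{ij})$, and suppose $a_{12}>0$ (i.e. $v_1$ and $v_2$ are neighbors). If $\mathbf{d}$ is an arithmetical $d$-structure on $G$ with $d_1=1$, then $d_2>1$.
   Context: An arithmetical structure on a connected graph $G$ with $n$ vertices and adjacency matrix $A$ (entries $a_{ij}\ge 0$ counting edges between $v_i$ and $v_j$) is a pair $(\mathbf{d},\mathbf{r})$ of positive integer vectors in $\mathbb{Z}^n$ with $\mathbf{r}$ primitive (gcd of entries $1$) and $(\operatorname{diag}(\mathbf{d})-A)\mathbf{r}=\mathbf{0}$. Then $\mathbf{d}$ is called an arithmetical $d$-structure on $G$. -}

module Defs where

open import Data.Nat using (ℕ; zero; suc; _+_; _*_; _≤_; _<_)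
open import Data.Nat.Divisibility using (_∣_)
open import Data.Fin using (Fin; zero; suc)
open import Data.Product using (Σ; _×_)
open import Relation.Binary.PropositionalEquality using (_≡_)

Σᶠ : ∀ {n} → (Fin n → ℕ) → ℕ
Σᶠ {zero}  f = 0
Σᶠ {suc n} f = f zero + Σᶠ {n} (λ i → f (suc i))

record MultiGraph (n : ℕ) : Set where
  field
    adj       : Fin n → Fin n → ℕ
    symmetric : ∀ i j → adj i j ≡ adj j i
    loopless  : ∀ i → adj i i ≡ 0
open MultiGraph public

data Walk {n : ℕ} (G : MultiGraph n) : Fin n → Fin n → Set where
  here : ∀ {i} → Walk G i i
  step : ∀ {i j k} → 0 < adj G i j → Walk G j k → Walk G i k

Connected : ∀ {n} → MultiGraph n → Set
Connected {n} G = ∀ (i j : Fin n) → Walk G i j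

Primitive : ∀ {n} → (Fin n → ℕ) → Set
Primitive {n} r = ∀ (c : ℕ) → (∀ i → c ∣ r i) → c ∣ 1

-- (d , r) is an arithmetical structure on G:
-- d, r positive, r primitive, (diag d - A) r = 0, i.e. d_i r_i = Σ_j a_ij r_j.
IsArithmeticalStructure : ∀ {n} → MultiGraph n → (Fin n → ℕ) → (Fin n → ℕ) → Set
IsArithmeticalStructure {n} G d r =
  (∀ i → 0 < d i) × (∀ i → 0 < r i) × Primitive r ×
  (∀ i → d i * r i ≡ Σᶠ (λ j → adj G i j * r j))

IsArithmeticalDStructure : ∀ {n} → MultiGraph n → (Fin n → ℕ) → Set
IsArithmeticalDStructure {n} G d = Σ (Fin n → ℕ) (λ r → IsArithmeticalStructure G d r)

module Submission where

-- If d₁ = d₂ = 1 on adjacent vertices, the balance equations give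
-- r₁ ≥ a₁₂ r₂ ≥ r₂ and r₂ ≥ r₁, so r₁ = r₂ and any further neighbour of v₁
-- (or of v₂) would make r₁ > r₂. Hence {v₁, v₂} is closed under adjacency,
-- which contradicts connectedness once there is a third vertex.

open import Defs
open import Data.Nat using (ℕ; _<_; _+_; _*_; _≤_; zero; suc; >-nonZero)
open import Data.Nat.Properties hiding (_≟_)
open import Data.Fin using (Fin; zero; suc; _≟_)
open import Data.Product using (_,_)
open import Data.Sum using (_⊎_; inj₁; inj₂; [_,_]′)
open import Function using (_∘_)
open import Relation.Nullary using (yes; no; contradiction)
open import Relation.Binary.PropositionalEquality

≤-Σᶠ : ∀ {n} (f : Fin n → ℕ) i → f i ≤ Σᶠ f
≤-Σᶠ f zero    = m≤m+n _ _
≤-Σᶠ f (suc i) = ≤-trans (≤-Σᶠ (λ x → f (suc x)) i) (m≤n+m _ _)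

+-≤-Σᶠ : ∀ {n} (f : Fin n → ℕ) {i j} → i ≢ j → f i + f j ≤ Σᶠ f
+-≤-Σᶠ f {zero}  {zero}  i≢j = contradiction refl i≢j
+-≤-Σᶠ f {zero}  {suc j} _   = +-monoʳ-≤ (f zero) (≤-Σᶠ (λ x → f (suc x)) j)
+-≤-Σᶠ f {suc i} {zero}  _   = subst (_≤ Σᶠ f) (+-comm (f zero) (f (suc i)))
  (+-monoʳ-≤ (f zero) (≤-Σᶠ (λ x → f (suc x)) i))
+-≤-Σᶠ f {suc i} {suc j} i≢j =
  ≤-trans (+-≤-Σᶠ (λ x → f (suc x)) (λ i≡j → i≢j (cong suc i≡j))) (m≤n+m _ _)

walk-preserves : ∀ {n} {G : MultiGraph n} (S : Fin n → Set) →
  (∀ {i j} → S i → 0 < adj G i j → S j) →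
  ∀ {i j} → S i → Walk G i j → S j
walk-preserves S closed s here       = s
walk-preserves S closed s (step p w) = walk-preserves S closed (closed s p) w

module Balanced {n} (G : MultiGraph n) {d r : Fin n → ℕ}
  (balance : ∀ i → d i * r i ≡ Σᶠ (λ j → adj G i j * r j)) where

  private
    weight : Fin n → Fin n → ℕ
    weight i j = adj G i j * r j

    neighbour-weight : ∀ {i j} → 0 < adj G i j → r j ≤ weight i j
    neighbour-weight {i} {j} p = m≤n*m (r j) (adj G i j) {{>-nonZero p}}

    d≡1⇒Σ≡r : ∀ {i} → d i ≡ 1 → Σᶠ (weight i) ≡ r i
    d≡1⇒Σ≡r {i} di≡1 = begin
      Σᶠ (weight i) ≡⟨ sym (balance i) ⟩
      d i * r i     ≡⟨ cong (_* r i) di≡1 ⟩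
      1 * r i       ≡⟨ *-identityˡ (r i) ⟩
      r i           ∎
      where open ≡-Reasoning

  d≡1⇒neighbour-≤ : ∀ {i j} → d i ≡ 1 → 0 < adj G i j → r j ≤ r i
  d≡1⇒neighbour-≤ {i} {j} di≡1 p = begin
    r j           ≤⟨ neighbour-weight p ⟩
    weight i j    ≤⟨ ≤-Σᶠ (weight i) j ⟩
    Σᶠ (weight i) ≡⟨ d≡1⇒Σ≡r di≡1 ⟩
    r i           ∎
    where open ≤-Reasoning

  d≡1⇒neighbours-+-≤ : ∀ {i j k} → d i ≡ 1 → j ≢ k →
    0 < adj G i j → 0 < adj G i k → r j + r k ≤ r i
  d≡1⇒neighbours-+-≤ {i} {j} {k} di≡1 j≢k p q = begin
    r j + r k               ≤⟨ +-mono-≤ (neighbour-weight p) (neighbour-weight q) ⟩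
    weight i j + weight i k ≤⟨ +-≤-Σᶠ (weight i) j≢k ⟩
    Σᶠ (weight i)           ≡⟨ d≡1⇒Σ≡r di≡1 ⟩
    r i                     ∎
    where open ≤-Reasoning

  unit-pair-only-neighbour : (∀ i → 0 < r i) → ∀ {i j k} →
    d i ≡ 1 → d j ≡ 1 → 0 < adj G i j → 0 < adj G i k → k ≡ j
  unit-pair-only-neighbour r-pos {i} {j} {k} di≡1 dj≡1 p q with k ≟ j
  ... | yes k≡j = k≡j
  ... | no  k≢j = contradiction ri≤rj (<⇒≱ rj<ri)
    where
    ri≤rj : r i ≤ r j
    ri≤rj = d≡1⇒neighbour-≤ dj≡1 (subst (0 <_) (symmetric G i j) p)
    rj<ri : r j < r i
    rj<ri = <-≤-trans (m<m+n (r j) (r-pos k))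
                      (d≡1⇒neighbours-+-≤ di≡1 (k≢j ∘ sym) p q)

lemma2p6 : (k : ℕ) → (G : MultiGraph (3 + k)) → Connected G →
    0 < adj G zero (suc zero) →
    (d : Fin (3 + k) → ℕ) → IsArithmeticalDStructure G d →
    d zero ≡ 1 → 1 < d (suc zero)
lemma2p6 k G connected a₁₂>0 d (r , d-pos , r-pos , _ , balance) d₁≡1 =
  ≤∧≢⇒< (d-pos (suc zero)) d₂≢1
  where
  open Balanced G {d} {r} balance

  v₁ v₂ v₃ : Fin (3 + k)
  v₁ = zero
  v₂ = suc zero
  v₃ = suc (suc zero)

  IsV₁orV₂ : Fin (3 + k) → Set
  IsV₁orV₂ i = i ≡ v₁ ⊎ i ≡ v₂

  d₂≢1 : 1 ≢ d v₂
  d₂≢1 1≡d₂ = [ (λ ()) , (λ ()) ]′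
    (walk-preserves IsV₁orV₂ closed (inj₁ refl) (connected v₁ v₃))
    where
    closed : ∀ {i j} → IsV₁orV₂ i → 0 < adj G i j → IsV₁orV₂ j
    closed (inj₁ refl) p = inj₂ (unit-pair-only-neighbour r-pos d₁≡1 (sym 1≡d₂) a₁₂>0 p)
    closed (inj₂ refl) p = inj₁ (unit-pair-only-neighbour r-pos (sym 1≡d₂) d₁≡1
                                   (subst (0 <_) (symmetric G v₁ v₂) a₁₂>0) p)
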